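{- Fix an integer $t\geq 1$. For every integer $n\geq 1$, the number $p(n,t)$ of partitions of $n$ whose largest part minus smallest part is at most $t$ equals the number of pairs $(\lambda,\ell)$ where $\ell\in\mathbb{Z}_{\geq 0}$ is divisible by $t$ and $\lambda$ is a non-empty partition of $n-\ell$ with largest part at most $t$. Moreover, there is an explicit bijection between these two sets.
   Context: A partition of $n$ is a weakly decreasing finite sequence of positive integers summing to $n$; partitions counted by $p(n,t)$ are non-empty. -}

module Defs where

open import Data.Nat using (ℕ; zero; suc; _+_; _∸_; _≤_; _<_; _≥_; _⊔_; _⊓_)
open import Data.Nat.Divisibility using (_∣_)
open import Data.List using (List; []; _∷_; length; foldr)
open import Data.Nat.ListAction using (sum)
open import Data.List.Relation.Unary.All using (All)
open import Data.List.Relation.Unary.Linked using (Linked)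
open import Data.Product using (Σ; _×_)
open import Relation.Binary.PropositionalEquality using (_≡_)

-- A partition of n: a non-empty (per the paper's convention for p(n,t))
-- weakly decreasing finite list of positive integers summing to n.
-- Non-emptiness is expressed as 0 < length λ.
IsPartition : ℕ → List ℕ → Set
IsPartition n ps = Linked _≥_ ps × All (0 <_) ps × sum ps ≡ n × 0 < length ps

largest : List ℕ → ℕ
largest = foldr _⊔_ 0

smallest : List ℕ → ℕ
smallest [] = 0
smallest (x ∷ []) = x
smallest (x ∷ y ∷ ys) = x ⊓ smallest (y ∷ ys)

PartsSpread : ℕ → ℕ → Set
PartsSpread n t = Σ (List ℕ) λ ps → IsPartition n ps × largest ps ∸ smallest ps ≤ t

PairsBounded : ℕ → ℕ → Set
PairsBounded n t = Σ (List ℕ) λ ps → Σ ℕ λ ℓ →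
  t ∣ ℓ × ℓ ≤ n × IsPartition (n ∸ ℓ) ps × largest ps ≤ t

-- Write a partition of n with largest − smallest ≤ t as a decreasing list x₁ ≥ … ≥ xᵣ with
-- x₁ ≤ xᵣ + t. While x₁ > t, "lower" it: delete x₁ and append x₁ − t as the new smallest
-- part. The result is again such a partition, of n − t. Conversely "raise" deletes the
-- smallest part xᵣ and prepends xᵣ + t. Every partition is therefore reached by raising, a
-- unique number k of times, a unique partition of n − k t with largest part ≤ t; the
-- bijection sends it to that partition paired with ℓ = k t.
module Submission where

open import Defs
open import Data.Nat using (ℕ; _≤_)
open import Function.Bundles using (_⤖_)

open import Data.Nat using (zero; suc; _+_; _*_; _∸_; _<_; _≥_; _⊔_; _⊓_; z≤n; s≤s; _≤?_; NonZero; >-nonZero; >-nonZero⁻¹)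
open import Data.Nat.Properties
open import Data.Nat.Divisibility using (_∣_; divides)
open import Data.Nat.GeneralisedArithmetic using (fold)
open import Data.Nat.Induction using (<-wellFounded)
open import Data.Nat.ListAction using (sum)
open import Data.Nat.ListAction.Properties using (sum-++)
open import Data.List using (List; []; _∷_; _∷ʳ_)
open import Data.List.Relation.Unary.All as All using (All; []; _∷_)
open import Data.List.Relation.Unary.All.Properties using (∷ʳ⁺)
open import Data.List.Relation.Unary.Linked as Linked using (Linked; []; [-]; _∷_)
open import Data.Product using (∃₂; _×_; _,_; proj₁; proj₂)
import Data.Product as Product
open import Data.Empty using (⊥; ⊥-elim)
open import Induction.WellFounded using (Acc; acc)
open import Level using (Level)
open import Relation.Binary.Core using (Rel)
open import Relation.Binary.Definitions using (Reflexive; Transitive)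
open import Relation.Nullary using (yes; no)
open import Relation.Binary.PropositionalEquality
open import Function.Bundles using (_↔_; mk↔ₛ′)
open import Function.Base using (flip)
open import Function.Properties.Inverse using (↔⇒⤖)

private
  variable
    a r : Level
    A : Set a

lastOf : A → List A → A
lastOf x []       = x
lastOf _ (y ∷ ys) = lastOf y ys

initOf : A → List A → List A
initOf _ []       = []
initOf x (y ∷ ys) = x ∷ initOf y ys

lastOf-∷ʳ : ∀ (x : A) xs y → lastOf x (xs ∷ʳ y) ≡ y
lastOf-∷ʳ _ []       _ = refl
lastOf-∷ʳ _ (z ∷ zs) y = lastOf-∷ʳ z zs y

initOf-∷ʳ : ∀ (x : A) xs y → initOf x (xs ∷ʳ y) ≡ x ∷ xs
initOf-∷ʳ _ []       _ = refl
initOf-∷ʳ x (z ∷ zs) y = cong (x ∷_) (initOf-∷ʳ z zs y)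

initOf-∷ʳ-lastOf : ∀ (x : A) xs → initOf x xs ∷ʳ lastOf x xs ≡ x ∷ xs
initOf-∷ʳ-lastOf _ []       = refl
initOf-∷ʳ-lastOf x (y ∷ ys) = cong (x ∷_) (initOf-∷ʳ-lastOf y ys)

module _ {P : A → Set r} where

  All-lastOf : ∀ {x xs} → All P (x ∷ xs) → P (lastOf x xs)
  All-lastOf {xs = []}    (px ∷ _)   = px
  All-lastOf {xs = _ ∷ _} (_ ∷ pxs) = All-lastOf pxs

  All-initOf : ∀ {x xs} → All P (x ∷ xs) → All P (initOf x xs)
  All-initOf {xs = []}    _          = []
  All-initOf {xs = _ ∷ _} (px ∷ pxs) = px ∷ All-initOf pxs

module _ {R : Rel A r} where

  Linked-initOf : ∀ {x y ys} → Linked R (x ∷ y ∷ ys) → Linked R (x ∷ initOf y ys)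
  Linked-initOf {ys = []}    _           = [-]
  Linked-initOf {ys = _ ∷ _} (Rxy ∷ Rys) = Rxy ∷ Linked-initOf Rys

  Linked-∷ʳ : ∀ {x xs y} → Linked R (x ∷ xs) → R (lastOf x xs) y → Linked R ((x ∷ xs) ∷ʳ y)
  Linked-∷ʳ {xs = []}    [-]         Rxy = Rxy ∷ [-]
  Linked-∷ʳ {xs = _ ∷ _} (Rxz ∷ Rzs) Rzy = Rxz ∷ Linked-∷ʳ Rzs Rzy

  Linked⇒All-lastOf : Reflexive R → Transitive R →
                      ∀ {x xs} → Linked R (x ∷ xs) → All (λ y → R y (lastOf x xs)) (x ∷ xs)
  Linked⇒All-lastOf R-refl _       {xs = []}    _           = R-refl ∷ []
  Linked⇒All-lastOf R-refl R-trans {xs = _ ∷ _} (Rxy ∷ Rys) with Linked⇒All-lastOf R-refl R-trans Rys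
  ... | Ry∙ ∷ R∙ = R-trans Rxy Ry∙ ∷ Ry∙ ∷ R∙

Decreasing : List ℕ → Set
Decreasing = Linked _≥_

lastOf-minimum : ∀ {x xs} → Decreasing (x ∷ xs) → All (lastOf x xs ≤_) (x ∷ xs)
lastOf-minimum = Linked⇒All-lastOf ≤-refl (flip ≤-trans)

largest-decreasing : ∀ {x xs} → Decreasing (x ∷ xs) → largest (x ∷ xs) ≡ x
largest-decreasing {x} {[]}    _         = ⊔-identityʳ x
largest-decreasing {x} {_ ∷ _} (x≥y ∷ d) = trans (cong (x ⊔_) (largest-decreasing d)) (m≥n⇒m⊔n≡m x≥y)

smallest-decreasing : ∀ {x xs} → Decreasing (x ∷ xs) → smallest (x ∷ xs) ≡ lastOf x xs
smallest-decreasing {x} {[]}    _          = refl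
smallest-decreasing {x} {_ ∷ _} d@(_ ∷ d′) =
  trans (cong (x ⊓_) (smallest-decreasing d′)) (m≥n⇒m⊓n≡n (All.head (lastOf-minimum d)))

sum-∷ʳ : ∀ xs y → sum (xs ∷ʳ y) ≡ sum xs + y
sum-∷ʳ xs y = trans (sum-++ xs (y ∷ [])) (cong (sum xs +_) (+-identityʳ y))

isPartition-irrelevant : ∀ {n ps} (p q : IsPartition n ps) → p ≡ q
isPartition-irrelevant (d , pos , s , ne) (d′ , pos′ , s′ , ne′) =
  cong₂ _,_ (Linked.irrelevant ≤-irrelevant d d′)
    (cong₂ _,_ (All.irrelevant ≤-irrelevant pos pos′)
      (cong₂ _,_ (≡-irrelevant s s′) (≤-irrelevant ne ne′)))

∣-irrelevant : ∀ {m n} .{{_ : NonZero m}} (p q : m ∣ n) → p ≡ q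
∣-irrelevant {m} (divides a e) (divides b e′) with *-cancelʳ-≡ a b m (trans (sym e) e′)
... | refl = cong (divides a) (≡-irrelevant e e′)

PartsSpread-≡ : ∀ {n t} {p q : PartsSpread n t} → proj₁ p ≡ proj₁ q → p ≡ q
PartsSpread-≡ {p = ps , ip , sp} {q = .ps , ip′ , sp′} refl =
  cong (ps ,_) (cong₂ _,_ (isPartition-irrelevant ip ip′) (≤-irrelevant sp sp′))

PairsBounded-≡ : ∀ {n t} .{{_ : NonZero t}} {p q : PairsBounded n t} →
                 proj₁ p ≡ proj₁ q → proj₁ (proj₂ p) ≡ proj₁ (proj₂ q) → p ≡ q
PairsBounded-≡ {p = ps , ℓ , t∣ℓ , ℓ≤n , ip , lg} {q = .ps , .ℓ , t∣ℓ′ , ℓ≤n′ , ip′ , lg′} refl refl =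
  cong (λ rest → ps , ℓ , rest)
    (cong₂ _,_ (∣-irrelevant t∣ℓ t∣ℓ′)
      (cong₂ _,_ (≤-irrelevant ℓ≤n ℓ≤n′)
        (cong₂ _,_ (isPartition-irrelevant ip ip′) (≤-irrelevant lg lg′))))

module Raising (t : ℕ) .{{_ : NonZero t}} where

  Narrow : List ℕ → Set
  Narrow []       = ⊥
  Narrow (x ∷ xs) = Decreasing (x ∷ xs) × All (0 <_) (x ∷ xs) × x ≤ lastOf x xs + t

  Reduced : List ℕ → Set
  Reduced μ = Narrow μ × largest μ ≤ t

  lower : List ℕ → List ℕ
  lower []       = []
  lower (x ∷ xs) = xs ∷ʳ (x ∸ t)

  raise : List ℕ → List ℕ
  raise []       = []
  raise (x ∷ xs) = (lastOf x xs + t) ∷ initOf x xs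

  lower-raise : ∀ l → lower (raise l) ≡ l
  lower-raise []       = refl
  lower-raise (x ∷ xs) =
    trans (cong (initOf x xs ∷ʳ_) (m+n∸n≡m (lastOf x xs) t)) (initOf-∷ʳ-lastOf x xs)

  raise-∷ʳ : ∀ xs y → raise (xs ∷ʳ y) ≡ (y + t) ∷ xs
  raise-∷ʳ []       _ = refl
  raise-∷ʳ (z ∷ zs) y = cong₂ (λ u v → (u + t) ∷ v) (lastOf-∷ʳ z zs y) (initOf-∷ʳ z zs y)

  raise-lower : ∀ {x} xs → t ≤ x → raise (lower (x ∷ xs)) ≡ x ∷ xs
  raise-lower {x} xs t≤x = trans (raise-∷ʳ xs (x ∸ t)) (cong (_∷ xs) (m∸n+n≡m t≤x))

  raise-injective : ∀ {l l′} → raise l ≡ raise l′ → l ≡ l′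
  raise-injective {l} {l′} eq = trans (sym (lower-raise l)) (trans (cong lower eq) (lower-raise l′))

  sum-lower : ∀ {x} xs → t ≤ x → sum (lower (x ∷ xs)) + t ≡ sum (x ∷ xs)
  sum-lower {x} xs t≤x = begin
    sum (xs ∷ʳ (x ∸ t)) + t   ≡⟨ cong (_+ t) (sum-∷ʳ xs (x ∸ t)) ⟩
    sum xs + (x ∸ t) + t      ≡⟨ +-assoc (sum xs) (x ∸ t) t ⟩
    sum xs + (x ∸ t + t)      ≡⟨ cong (sum xs +_) (m∸n+n≡m t≤x) ⟩
    sum xs + x                ≡⟨ +-comm (sum xs) x ⟩
    x + sum xs                ∎
    where open ≡-Reasoning

  sum-raise : ∀ l → Narrow l → sum (raise l) ≡ sum l + t
  sum-raise l@(x ∷ xs) _ = begin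
    sum (raise l)                 ≡⟨ sym (sum-lower (initOf x xs) (m≤n+m t (lastOf x xs))) ⟩
    sum (lower (raise l)) + t     ≡⟨ cong (λ l′ → sum l′ + t) (lower-raise l) ⟩
    sum l + t                     ∎
    where open ≡-Reasoning

  narrow-lower : ∀ {x} xs → t < x → Narrow (x ∷ xs) → Narrow (lower (x ∷ xs))
  narrow-lower {x} [] t<x _ = [-] , m<n⇒0<n∸m t<x ∷ [] , m≤m+n (x ∸ t) t
  narrow-lower {x} (y ∷ ys) t<x (x≥y ∷ d , pos , x≤last+t) =
      Linked-∷ʳ d (m≤n+o⇒m∸n≤o x t (subst (x ≤_) (+-comm (lastOf y ys) t) x≤last+t))
    , All.tail (∷ʳ⁺ pos (m<n⇒0<n∸m t<x))
    , subst (y ≤_) (sym (trans (cong (_+ t) (lastOf-∷ʳ y ys (x ∸ t))) (m∸n+n≡m (<⇒≤ t<x)))) x≥y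

  narrow-raise : ∀ l → Narrow l → Narrow (raise l)
  narrow-raise (x ∷ []) (_ , 0<x ∷ [] , _) = [-] , ≤-trans 0<x (m≤m+n x t) ∷ [] , m≤m+n (x + t) t
  narrow-raise (x ∷ y ∷ ys) (d , pos , x≤last+t) =
      x≤last+t ∷ Linked-initOf d
    , ≤-trans (All-lastOf pos) (m≤m+n _ t) ∷ All-initOf pos
    , +-monoˡ-≤ t (All-lastOf (All-initOf (lastOf-minimum d)))

  t<largest-raise : ∀ l → Narrow l → t < largest (raise l)
  t<largest-raise (x ∷ xs) (_ , pos , _) =
    ≤-trans (+-monoˡ-< t (All-lastOf pos)) (m≤m⊔n (lastOf x xs + t) (largest (initOf x xs)))

  narrow-fold : ∀ {μ} k → Narrow μ → Narrow (fold μ raise k)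
  narrow-fold zero    nμ = nμ
  narrow-fold (suc k) nμ = narrow-raise _ (narrow-fold k nμ)

  sum-fold : ∀ {μ} k → Narrow μ → sum (fold μ raise k) ≡ sum μ + k * t
  sum-fold {μ} zero    _  = sym (+-identityʳ (sum μ))
  sum-fold {μ} (suc k) nμ = begin
    sum (raise (fold μ raise k))   ≡⟨ sum-raise _ (narrow-fold k nμ) ⟩
    sum (fold μ raise k) + t       ≡⟨ cong (_+ t) (sum-fold k nμ) ⟩
    sum μ + k * t + t              ≡⟨ +-assoc (sum μ) (k * t) t ⟩
    sum μ + (k * t + t)            ≡⟨ cong (sum μ +_) (+-comm (k * t) t) ⟩
    sum μ + suc k * t              ∎
    where open ≡-Reasoning

  fold-raise-unique : ∀ {μ ν} j k → Reduced μ → Reduced ν →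
                      fold μ raise j ≡ fold ν raise k → μ ≡ ν × j ≡ k
  fold-raise-unique zero zero _ _ eq = eq , refl
  fold-raise-unique zero (suc k) (_ , μ≤t) (nν , _) eq =
    ⊥-elim (<⇒≱ (t<largest-raise _ (narrow-fold k nν)) (subst (λ l → largest l ≤ t) eq μ≤t))
  fold-raise-unique (suc j) zero rμ rν eq =
    Product.map sym sym (fold-raise-unique zero (suc j) rν rμ (sym eq))
  fold-raise-unique (suc j) (suc k) rμ rν eq =
    Product.map₂ (cong suc) (fold-raise-unique j k rμ rν (raise-injective eq))

  Decomposition : List ℕ → Set
  Decomposition l = ∃₂ λ μ k → Reduced μ × fold μ raise k ≡ l

  decompose : ∀ l → Narrow l → Acc _<_ (sum l) → Decomposition l
  decompose l@(x ∷ xs) nl@(d , _) (acc rec) with x ≤? t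
  ... | yes x≤t = l , 0 , (nl , subst (_≤ t) (sym (largest-decreasing d)) x≤t) , refl
  ... | no x≰t = raiseDecomposition (decompose (lower l) (narrow-lower xs t<x nl) (rec sum-lower<sum))
    where
      t<x : t < x
      t<x = ≰⇒> x≰t

      sum-lower<sum : sum (lower l) < sum l
      sum-lower<sum = subst (sum (lower l) <_) (sum-lower xs (<⇒≤ t<x)) (m<m+n _ (>-nonZero⁻¹ t))

      raiseDecomposition : Decomposition (lower l) → Decomposition l
      raiseDecomposition (μ , k , rμ , eq) = μ , suc k , rμ , trans (cong raise eq) (raise-lower xs (<⇒≤ t<x))

  narrow : ∀ {n ps} → IsPartition n ps → largest ps ∸ smallest ps ≤ t → Narrow ps
  narrow {ps = x ∷ xs} (d , pos , _) spread =
    d , pos , ≤-trans (m≤n+m∸n x (lastOf x xs)) (+-monoʳ-≤ (lastOf x xs) x∸last≤t)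
    where
      x∸last≤t : x ∸ lastOf x xs ≤ t
      x∸last≤t = subst₂ (λ u v → u ∸ v ≤ t) (largest-decreasing d) (smallest-decreasing d) spread

  narrow-spread : ∀ ps → Narrow ps → largest ps ∸ smallest ps ≤ t
  narrow-spread (x ∷ xs) (d , _ , x≤last+t) =
    subst₂ (λ u v → u ∸ v ≤ t) (sym (largest-decreasing d)) (sym (smallest-decreasing d))
      (m≤n+o⇒m∸n≤o x (lastOf x xs) x≤last+t)

  narrow-isPartition : ∀ {n} ps → Narrow ps → sum ps ≡ n → IsPartition n ps
  narrow-isPartition (_ ∷ _) (d , pos , _) Σps≡n = d , pos , Σps≡n , s≤s z≤n

  reduced : ∀ {n μ} → IsPartition n μ → largest μ ≤ t → Reduced μ
  reduced {μ = μ} ip μ≤t = narrow ip (≤-trans (m∸n≤m (largest μ) (smallest μ)) μ≤t) , μ≤t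

  pairOf : ∀ {n ps} → sum ps ≡ n → Decomposition ps → PairsBounded n t
  pairOf {n} Σps≡n (μ , k , (nμ , μ≤t) , eq) =
    μ , k * t , divides k refl , kt≤n , narrow-isPartition μ nμ Σμ≡n∸kt , μ≤t
    where
      Σμ+kt≡n : sum μ + k * t ≡ n
      Σμ+kt≡n = trans (sym (sum-fold k nμ)) (trans (cong sum eq) Σps≡n)

      kt≤n : k * t ≤ n
      kt≤n = subst (k * t ≤_) Σμ+kt≡n (m≤n+m (k * t) (sum μ))

      Σμ≡n∸kt : sum μ ≡ n ∸ k * t
      Σμ≡n∸kt = trans (sym (m+n∸n≡m (sum μ) (k * t))) (cong (_∸ k * t) Σμ+kt≡n)

  toPair : ∀ {n} → PartsSpread n t → PairsBounded n t
  toPair (ps , ip@(_ , _ , Σps≡n , _) , spread) =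
    pairOf Σps≡n (decompose ps (narrow ip spread) (<-wellFounded (sum ps)))

  fromPair : ∀ {n} → PairsBounded n t → PartsSpread n t
  fromPair {n} (μ , ℓ , divides k ℓ≡kt , ℓ≤n , ip@(_ , _ , Σμ≡n∸ℓ , _) , μ≤t) =
    fold μ raise k , narrow-isPartition _ nλ Σλ≡n , narrow-spread _ nλ
    where
      nμ : Narrow μ
      nμ = proj₁ (reduced ip μ≤t)

      nλ : Narrow (fold μ raise k)
      nλ = narrow-fold k nμ

      Σλ≡n : sum (fold μ raise k) ≡ n
      Σλ≡n = begin
        sum (fold μ raise k)   ≡⟨ sum-fold k nμ ⟩
        sum μ + k * t          ≡⟨ cong₂ _+_ Σμ≡n∸ℓ (sym ℓ≡kt) ⟩
        n ∸ ℓ + ℓ              ≡⟨ m∸n+n≡m ℓ≤n ⟩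
        n                      ∎
        where open ≡-Reasoning

  fromPair∘toPair : ∀ {n} (p : PartsSpread n t) → fromPair (toPair p) ≡ p
  fromPair∘toPair (ps , ip , spread) =
    PartsSpread-≡ (proj₂ (proj₂ (proj₂ (decompose ps (narrow ip spread) (<-wellFounded (sum ps))))))

  toPair∘fromPair : ∀ {n} (p : PairsBounded n t) → toPair (fromPair p) ≡ p
  toPair∘fromPair {n} p@(μ , ℓ , divides k ℓ≡kt , _ , ip , μ≤t) = pairOf-unique (decompose _ _ _)
    where
      pairOf-unique : ∀ {Σλ≡n : sum (fold μ raise k) ≡ n} (d : Decomposition (fold μ raise k)) →
                      pairOf Σλ≡n d ≡ p
      pairOf-unique (μ′ , k′ , rμ′ , eq) with fold-raise-unique k′ k rμ′ (reduced ip μ≤t) eq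
      ... | refl , refl = PairsBounded-≡ refl (sym ℓ≡kt)

  spread↔pairs : ∀ {n} → PartsSpread n t ↔ PairsBounded n t
  spread↔pairs = mk↔ₛ′ toPair fromPair toPair∘fromPair fromPair∘toPair

theorem3 : (t : ℕ) → 1 ≤ t → (n : ℕ) → 1 ≤ n → PartsSpread n t ⤖ PairsBounded n t
theorem3 t 1≤t n _ = ↔⇒⤖ spread↔pairs
  where
    instance
      t≢0 : NonZero t
      t≢0 = >-nonZero 1≤t
    open Raising t
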